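{- Let $s:\mathbb{N}\to\mathbb{N}$ be monotone with $s(x)\geq x$, and consider fundamental sequences with $\omega_x=s(x)$. For all ordinal terms $\alpha,\beta$ and all $x\leq y$ in $\mathbb{N}$, $\alpha\prec_x\beta$ implies $\alpha\prec_y\beta$.
   Context: Ordinal terms follow the syntax $\alpha::=0\mid\omega^\alpha\mid\alpha+\alpha$, modulo associativity of $+$ and with $0$ neutral; $1=\omega^0$, $\alpha\cdot n$ the $n$-fold sum. Terms $\gamma+1$ are successors, other nonzero terms are limits $\gamma+\omega^\beta$ ($\beta\neq0$). Fundamental sequences: $(\gamma+\omega^{\beta+1})_x=\gamma+\omega^\beta\cdot s(x)$, $(\gamma+\omega^{\lambda})_x=\gamma+\omega^{\lambda_x}$. $\prec_x$ is the smallest transitive relation with $\alpha\prec_x\alpha+1$ and $\lambda_x\prec_x\lambda$ for all limits $\lambda$. -}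

module Defs where

open import Data.Nat using (ℕ; zero; suc)
open import Relation.Binary.Construct.Closure.Transitive using (TransClosure)

-- Ordinal terms modulo associativity of + with 0 neutral, i.e. finite
-- (snoc-)lists of summands ω^β.  `γ +ω^ β` denotes γ + ω^β.
infixl 6 _+ω^_
data OT : Set where
  𝟎     : OT
  _+ω^_ : OT → OT → OT

ω^ : OT → OT
ω^ β = 𝟎 +ω^ β

𝟏 : OT
𝟏 = ω^ 𝟎

infixl 6 _⊕_
_⊕_ : OT → OT → OT
α ⊕ 𝟎 = α
α ⊕ (γ +ω^ β) = (α ⊕ γ) +ω^ β

_·_ : OT → ℕ → OT
α · zero = 𝟎
α · suc n = (α · n) ⊕ α

-- Limits are exactly the
-- terms γ + ω^(β + ω^δ) (exponent nonzero).  The values on 0 and on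
-- successors are irrelevant (never used by ≺) and set arbitrarily.
fs : (ℕ → ℕ) → OT → ℕ → OT
fs s 𝟎 x = 𝟎
fs s (γ +ω^ 𝟎) x = γ +ω^ 𝟎
fs s (γ +ω^ (β +ω^ 𝟎)) x = γ ⊕ (ω^ β · s x)
fs s (γ +ω^ (β +ω^ (δ +ω^ ε))) x = γ +ω^ fs s (β +ω^ (δ +ω^ ε)) x

data Step (s : ℕ → ℕ) (x : ℕ) : OT → OT → Set where
  succ : ∀ α → Step s x α (α ⊕ 𝟏)
  lim  : ∀ γ β δ → Step s x (fs s (γ +ω^ (β +ω^ δ)) x) (γ +ω^ (β +ω^ δ))

_≺[_,_]_ : OT → (ℕ → ℕ) → ℕ → OT → Set
α ≺[ s , x ] β = TransClosure (Step s x) α β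

module Submission where

-- A derivation of α ≺_x β is a chain of generating steps, so it suffices to
-- replace each step at level x by a chain at level y ≥ x.  Successor steps
-- do not depend on the level.  A limit step λ_x ≺_x λ is replaced by
-- λ_x ≼_y λ_y ≺_y λ, so everything rests on the comparison λ_x ≼_y λ_y.
--
-- Fixing the level y, we first show that ≺_y is invariant under left
-- addition δ ⊕ _ and that n ↦ α·n is ≼_y-monotone whenever 𝟎 ≺_y α.
-- Provided s y ≥ 1, β ↦ ω^β is strictly ≺_y-monotone and 𝟎 ≺_y ω^β for
-- every β (these two facts are proved simultaneously).  Unfolding the
-- definition of fundamental sequences then yields λ_x ≼_y λ_y as soon as
-- s x ≤ s y.  If s y = s x the fundamental sequences coincide outright;
-- otherwise s y ≥ 1.

open import Defs
open import Data.Nat using (ℕ; suc; _≤_; _<_; _≤′_; ≤′-refl; ≤′-step; s≤s; z≤n)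
open import Data.Nat.Properties using (≤-trans; <⇒≤; ≤⇒≤′; m≤n⇒m<n∨m≡n)
open import Data.Sum using (_⊎_; inj₁; inj₂)
open import Relation.Binary.PropositionalEquality using (_≡_; refl; sym; cong; subst; subst₂)
open import Relation.Binary.Construct.Closure.Transitive using ([_]; _∷_; _++_)

⊕-assoc : ∀ α β γ → (α ⊕ β) ⊕ γ ≡ α ⊕ (β ⊕ γ)
⊕-assoc α β 𝟎 = refl
⊕-assoc α β (γ +ω^ δ) = cong (_+ω^ δ) (⊕-assoc α β γ)

⊕-identityˡ : ∀ α → 𝟎 ⊕ α ≡ α
⊕-identityˡ 𝟎 = refl
⊕-identityˡ (α +ω^ β) = cong (_+ω^ β) (⊕-identityˡ α)

fs-cong : ∀ s {x y} → s x ≡ s y → ∀ λ' → fs s λ' x ≡ fs s λ' y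
fs-cong s eq 𝟎 = refl
fs-cong s eq (γ +ω^ 𝟎) = refl
fs-cong s eq (γ +ω^ (β +ω^ 𝟎)) = cong (λ n → γ ⊕ (ω^ β · n)) eq
fs-cong s eq (γ +ω^ (β +ω^ (δ +ω^ ε))) = cong (γ +ω^_) (fs-cong s eq (β +ω^ (δ +ω^ ε)))

module Level (s : ℕ → ℕ) (y : ℕ) where

  _≺_ : OT → OT → Set
  α ≺ β = α ≺[ s , y ] β

  _≼_ : OT → OT → Set
  α ≼ β = α ≡ β ⊎ α ≺ β

  ≼-≺-trans : ∀ {α β γ} → α ≼ β → β ≺ γ → α ≺ γ
  ≼-≺-trans (inj₁ refl) q = q
  ≼-≺-trans (inj₂ p) q = p ++ q

  ≼-trans : ∀ {α β γ} → α ≼ β → β ≼ γ → α ≼ γ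
  ≼-trans (inj₁ refl) q = q
  ≼-trans (inj₂ p) (inj₁ refl) = inj₂ p
  ≼-trans (inj₂ p) (inj₂ q) = inj₂ (p ++ q)

  -- Left addition preserves generating steps up to a chain: the fundamental
  -- sequence of δ ⊕ λ is δ ⊕ λ_y (by associativity in the case ω^(β+1)).
  shift-step : ∀ δ {α β} → Step s y α β → (δ ⊕ α) ≺ (δ ⊕ β)
  shift-step δ (succ α) = [ succ (δ ⊕ α) ]
  shift-step δ (lim γ β 𝟎) =
    subst (_≺ ((δ ⊕ γ) +ω^ (β +ω^ 𝟎))) (⊕-assoc δ γ (ω^ β · s y)) [ lim (δ ⊕ γ) β 𝟎 ]
  shift-step δ (lim γ β (d +ω^ e)) = [ lim (δ ⊕ γ) β (d +ω^ e) ]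

  shift : ∀ δ {α β} → α ≺ β → (δ ⊕ α) ≺ (δ ⊕ β)
  shift δ [ st ] = shift-step δ st
  shift δ (st ∷ p) = shift-step δ st ++ shift δ p

  shift≼ : ∀ δ {α β} → α ≼ β → (δ ⊕ α) ≼ (δ ⊕ β)
  shift≼ δ (inj₁ refl) = inj₁ refl
  shift≼ δ (inj₂ p) = inj₂ (shift δ p)

  ·-mono : ∀ {α} → 𝟎 ≺ α → ∀ {m n} → m ≤ n → (α · m) ≼ (α · n)
  ·-mono {α} pos m≤n = go (≤⇒≤′ m≤n)
    where
    go : ∀ {m n} → m ≤′ n → (α · m) ≼ (α · n)
    go ≤′-refl = inj₁ refl
    go {n = suc n} (≤′-step m≤′n) = ≼-trans (go m≤′n) (inj₂ (shift (α · n) pos))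

  module Positive (s-pos : 0 < s y) where

    -- ω^α ≼ ω^α · s y, the fundamental sequence of ω^(α+1); this is where s y ≥ 1 is used.
    ω^-below-successor : ∀ {α} → 𝟎 ≺ ω^ α → ω^ α ≼ fs s (ω^ (α ⊕ 𝟏)) y
    ω^-below-successor {α} pos =
      subst₂ _≼_ (⊕-identityˡ (ω^ α)) (sym (⊕-identityˡ (ω^ α · s y))) (·-mono pos s-pos)

    ω^-step : ∀ {α β} → 𝟎 ≺ ω^ α → Step s y α β → ω^ α ≺ ω^ β
    ω^-step {α} pos (succ α) = ≼-≺-trans (ω^-below-successor pos) [ lim 𝟎 α 𝟎 ]
    ω^-step pos (lim γ β δ) = [ lim 𝟎 γ (β +ω^ δ) ]

    -- Strict monotonicity of ω^_, carrying positivity of the current power along the chain.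
    ω^-mono′ : ∀ {α β} → 𝟎 ≺ ω^ α → α ≺ β → ω^ α ≺ ω^ β
    ω^-mono′ pos [ st ] = ω^-step pos st
    ω^-mono′ pos (st ∷ p) = let q = ω^-step pos st in q ++ ω^-mono′ (pos ++ q) p

    -- Every power of ω lies above 𝟎: 𝟎 ≺ ω^0 = 1 and ω^β ≺ ω^(β+ω^ν).
    ω^-pos : ∀ β → 𝟎 ≺ ω^ β
    ω^-pos 𝟎 = [ succ 𝟎 ]
    ω^-pos (β +ω^ ν) = ω^-pos β ++ ω^-mono′ (ω^-pos β) (shift β (ω^-pos ν))

    ω^-mono≼ : ∀ {α β} → α ≼ β → ω^ α ≼ ω^ β
    ω^-mono≼ (inj₁ refl) = inj₁ refl
    ω^-mono≼ {α} (inj₂ p) = inj₂ (ω^-mono′ (ω^-pos α) p)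

    fs-mono : ∀ {x} → s x ≤ s y → ∀ γ β δ →
              fs s (γ +ω^ (β +ω^ δ)) x ≼ fs s (γ +ω^ (β +ω^ δ)) y
    fs-mono sx≤sy γ β 𝟎 = shift≼ γ (·-mono (ω^-pos β) sx≤sy)
    fs-mono sx≤sy γ β (d +ω^ e) = shift≼ γ (ω^-mono≼ (fs-mono sx≤sy β d e))

  fs-≼ : ∀ {x} → s x ≤ s y → ∀ γ β δ →
         fs s (γ +ω^ (β +ω^ δ)) x ≼ fs s (γ +ω^ (β +ω^ δ)) y
  fs-≼ sx≤sy γ β δ with m≤n⇒m<n∨m≡n sx≤sy
  ... | inj₁ sx<sy = Positive.fs-mono (≤-trans (s≤s z≤n) sx<sy) (<⇒≤ sx<sy) γ β δ
  ... | inj₂ sx≡sy = inj₁ (fs-cong s sx≡sy (γ +ω^ (β +ω^ δ)))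

step-transfer : ∀ s {x y} → s x ≤ s y → ∀ {α β} → Step s x α β → α ≺[ s , y ] β
step-transfer s sx≤sy (succ α) = [ succ α ]
step-transfer s {y = y} sx≤sy (lim γ β δ) =
  Level.≼-≺-trans s y (Level.fs-≼ s y sx≤sy γ β δ) [ lim γ β δ ]

transfer : ∀ s {x y} → s x ≤ s y → ∀ {α β} → α ≺[ s , x ] β → α ≺[ s , y ] β
transfer s sx≤sy [ st ] = step-transfer s sx≤sy st
transfer s sx≤sy (st ∷ p) = step-transfer s sx≤sy st ++ transfer s sx≤sy p

corollary2 : (s : ℕ → ℕ) → (∀ {x y} → x ≤ y → s x ≤ s y) → (∀ x → x ≤ s x) →
    ∀ (α β : OT) (x y : ℕ) → x ≤ y → α ≺[ s , x ] β → α ≺[ s , y ] β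
corollary2 s mono _ α β x y x≤y = transfer s (mono x≤y)
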